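{- Let $(a_j)_{j\ge1}$ be nonnegative integers, $(b(j))_{j\ge1}$ nonnegative integers and $(c(j))_{j\ge1}$ positive integers such that for every $t$ only finitely many $j$ satisfy $c(j)=t$, and define $F_n(z)$ by $\sum_{n\ge0}F_n(z)q^n=\prod_{j\ge1}(1-z^{b(j)}q^{c(j)})^{ -a_j}$. Suppose $a_1=b(1)=c(1)=1$, there is an integer $m\ge2$ with $m\,b(j)\le c(j)$ for all $j\ge2$, $c(j)-b(j)>0$ for all $j>1$, and for each integer $D$ only finitely many $j$ satisfy $c(j)-b(j)=D$. Then for all $n\ge0$ and $0\le\ell\le n$, \[ [z^{n-\ell}]F_n(z)\le [z^{\ell}]\prod_{j\ge2}\frac{1}{(1-z^{c(j)-b(j)})^{a_j}} . \]
   Context: $[q^n]$ and $[z^k]$ denote coefficient extraction. -}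

module Defs where

open import Data.Nat using (ℕ; zero; suc; _+_; _*_; _∸_; _≤?_)
open import Data.Nat.Combinatorics using (_C_)
open import Data.Bool using (if_then_else_)
open import Relation.Nullary.Decidable using (⌊_⌋)
open import Data.Product using (_×_)
open import Relation.Nullary.Decidable using (_×-dec_)

sumTo : ℕ → (ℕ → ℕ) → ℕ
sumTo zero    f = f zero
sumTo (suc n) f = sumTo n f + f (suc n)

δ₀₀ : ℕ → ℕ → ℕ
δ₀₀ zero zero = 1
δ₀₀ _    _    = 0

δ₀ : ℕ → ℕ
δ₀ zero = 1
δ₀ _    = 0

-- [x^i] (1 - x)^{-a} = binom(a+i-1, i)
negBinom : ℕ → ℕ → ℕ
negBinom a i = (a + i ∸ 1) C i

-- Sequences are functions ℕ → ℕ indexed from j = 1 (the value at 0 is unused).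
-- Ftrunc a b c N n k = [q^n z^k] ∏_{j=1}^{N} (1 - z^{b j} q^{c j})^{-a j}.
-- (The sum over the power i of the j-th factor is cut at i ≤ n, which is exact
--  whenever c j ≥ 1.)
Ftrunc : (a b c : ℕ → ℕ) → ℕ → ℕ → ℕ → ℕ
Ftrunc a b c zero    n k = δ₀₀ n k
Ftrunc a b c (suc N) n k =
  sumTo n (λ i →
    if ⌊ (i * c (suc N) ≤? n) ×-dec (i * b (suc N) ≤? k) ⌋
    then negBinom (a (suc N)) i * Ftrunc a b c N (n ∸ i * c (suc N)) (k ∸ i * b (suc N))
    else 0)

-- Gtrunc a d N ℓ = [z^ℓ] ∏_{j=2}^{N} (1 - z^{d j})^{-a j}.
-- (The sum over i is cut at i ≤ ℓ, exact whenever d j ≥ 1 for j ≥ 2.)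
Gtrunc : (a d : ℕ → ℕ) → ℕ → ℕ → ℕ
Gtrunc a d zero          ℓ = δ₀ ℓ
Gtrunc a d (suc zero)    ℓ = δ₀ ℓ
Gtrunc a d (suc (suc N)) ℓ =
  sumTo ℓ (λ i →
    if ⌊ i * d (suc (suc N)) ≤? ℓ ⌋
    then negBinom (a (suc (suc N))) i * Gtrunc a d (suc N) (ℓ ∸ i * d (suc (suc N)))
    else 0)

-- Expanding the factor j ≥ 2 of the product, the q^n z^k coefficient of the partial
-- product is  Σ_i binom(a_j+i-1, i) · [q^(n - i c_j) z^(k - i b_j)] (earlier factors).
-- The exponent gap  (n - i c_j) - (k - i b_j)  equals  (n - k) - i (c_j - b_j), which
-- is exactly the shift in the z-exponent produced by the i-th term of the factor
-- (1 - z^(c_j - b_j))^(-a_j) on the right.  So, by induction on the number of factors,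
-- F_N(n, k) ≤ G_N(n - k) term by term; the induction starts from the factor
-- (1 - z q)^(-1), whose coefficient of q^n z^k is [n = k].  Coefficients with k > n
-- vanish because b_j ≤ c_j, which disposes of the terms that have no counterpart.
module Submission where

open import Defs
open import Data.Nat using (ℕ; _∸_; _*_; _≤_; _<_)
open import Data.Product using (Σ; ∃; _×_)
open import Relation.Binary.PropositionalEquality using (_≡_; _≢_)

open import Data.Nat
  using (zero; suc; _+_; _⊔_; _≤?_; _≤′_; ≤′-refl; ≤′-step; z≤n; s≤s; >-nonZero)
open import Data.Nat.Properties
open import Data.Nat.Combinatorics using (nCn≡1)
open import Data.Bool using (if_then_else_)
open import Data.Product using (_,_)
open import Relation.Nullary using (Dec; yes; no; contradiction)
open import Relation.Nullary.Decidable using (⌊_⌋; _×-dec_)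
open import Relation.Binary.PropositionalEquality
  using (refl; sym; trans; cong; cong₂; subst; module ≡-Reasoning)

guard : ∀ {p} {A : Set p} → Dec A → ℕ → ℕ
guard P x = if ⌊ P ⌋ then x else 0

module _ {p} {A : Set p} where

  guard-≤ : (P : Dec A) {x y : ℕ} → (A → x ≤ y) → guard P x ≤ y
  guard-≤ (yes a) x≤y = x≤y a
  guard-≤ (no _)  _   = z≤n

  guard-≡0 : (P : Dec A) {x : ℕ} → (A → x ≡ 0) → guard P x ≡ 0
  guard-≡0 P x≡0 = n≤0⇒n≡0 (guard-≤ P (λ a → ≤-reflexive (x≡0 a)))

  guard-yes : (P : Dec A) {x : ℕ} → A → guard P x ≡ x
  guard-yes (yes _) _ = refl
  guard-yes (no ¬a) a = contradiction a ¬a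

sumTo-mono-≤ : ∀ n {f g : ℕ → ℕ} → (∀ i → f i ≤ g i) → sumTo n f ≤ sumTo n g
sumTo-mono-≤ zero    f≤g = f≤g 0
sumTo-mono-≤ (suc n) f≤g = +-mono-≤ (sumTo-mono-≤ n f≤g) (f≤g (suc n))

sumTo-≡0 : ∀ n {f : ℕ → ℕ} → (∀ i → i ≤ n → f i ≡ 0) → sumTo n f ≡ 0
sumTo-≡0 zero    f≡0 = f≡0 0 z≤n
sumTo-≡0 (suc n) f≡0 =
  cong₂ _+_ (sumTo-≡0 n (λ i i≤n → f≡0 i (m≤n⇒m≤1+n i≤n))) (f≡0 (suc n) ≤-refl)

sumTo-last : ∀ n {f : ℕ → ℕ} → (∀ i → i < n → f i ≡ 0) → sumTo n f ≡ f n
sumTo-last zero    _   = refl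
sumTo-last (suc n) {f} f≡0 = cong (_+ f (suc n)) (sumTo-≡0 n (λ i i≤n → f≡0 i (s≤s i≤n)))

sumTo-truncate : ∀ {l n} {f : ℕ → ℕ} → l ≤′ n → (∀ i → l < i → f i ≡ 0) →
                 sumTo n f ≡ sumTo l f
sumTo-truncate ≤′-refl _ = refl
sumTo-truncate {l} {f = f} (≤′-step {n} l≤n) f≡0 = begin
  sumTo n f + f (suc n) ≡⟨ cong (_+ f (suc n)) (sumTo-truncate l≤n f≡0) ⟩
  sumTo l f + f (suc n) ≡⟨ cong (sumTo l f +_) (f≡0 (suc n) (s≤s (≤′⇒≤ l≤n))) ⟩
  sumTo l f + 0         ≡⟨ +-identityʳ _ ⟩
  sumTo l f             ∎
  where open ≡-Reasoning

δ₀₀-vanishesˡ : ∀ {x} y → 0 < x → δ₀₀ x y ≡ 0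
δ₀₀-vanishesˡ {suc _} zero    _ = refl
δ₀₀-vanishesˡ {suc _} (suc _) _ = refl

δ₀₀-vanishesʳ : ∀ x {y} → 0 < y → δ₀₀ x y ≡ 0
δ₀₀-vanishesʳ zero    {suc _} _ = refl
δ₀₀-vanishesʳ (suc _) {suc _} _ = refl

δ₀₀≤1 : ∀ x y → δ₀₀ x y ≤ 1
δ₀₀≤1 zero    zero    = ≤-refl
δ₀₀≤1 zero    (suc _) = z≤n
δ₀₀≤1 (suc _) _       = z≤n

negBinom-1 : ∀ i → negBinom 1 i ≡ 1
negBinom-1 = nCn≡1

eventually-constant : ∀ {a} {A : Set a} (f : ℕ → A) {N} →
                      (∀ K → N ≤ K → f (suc K) ≡ f K) → ∀ {K} → N ≤′ K → f N ≡ f K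
eventually-constant f step ≤′-refl          = refl
eventually-constant f step (≤′-step {K} N≤K) =
  trans (eventually-constant f step N≤K) (sym (step K (≤′⇒≤ N≤K)))

∸-split : ∀ {B C n k} → B ≤ C → C ≤ n → B ≤ k → k ∸ B ≤ n ∸ C →
          n ∸ k ≡ (C ∸ B) + ((n ∸ C) ∸ (k ∸ B))
∸-split {B} {C} {n} {k} B≤C C≤n B≤k y≤x = begin
  n ∸ k                  ≡⟨ cong₂ _∸_ (sym (m+[n∸m]≡n C≤n)) (sym (m+[n∸m]≡n B≤k)) ⟩
  (C + x) ∸ (B + y)      ≡⟨ sym (∸-+-assoc (C + x) B y) ⟩
  (C + x) ∸ B ∸ y        ≡⟨ cong (_∸ y) (+-∸-comm x B≤C) ⟩
  (C ∸ B) + x ∸ y        ≡⟨ +-∸-assoc (C ∸ B) y≤x ⟩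
  (C ∸ B) + (x ∸ y)      ∎
  where
  open ≡-Reasoning
  x y : ℕ
  x = n ∸ C
  y = k ∸ B

module _ (a b c : ℕ → ℕ) where

  private
    F : ℕ → ℕ → ℕ → ℕ
    F = Ftrunc a b c

    d : ℕ → ℕ
    d j = c j ∸ b j

    G : ℕ → ℕ → ℕ
    G = Gtrunc a d

  F-term : ℕ → ℕ → ℕ → ℕ → ℕ
  F-term N n k i = guard ((i * c (suc N) ≤? n) ×-dec (i * b (suc N) ≤? k))
    (negBinom (a (suc N)) i * F N (n ∸ i * c (suc N)) (k ∸ i * b (suc N)))

  G-term : ℕ → ℕ → ℕ → ℕ
  G-term N ℓ i = guard (i * d (suc (suc N)) ≤? ℓ)
    (negBinom (a (suc (suc N))) i * G (suc N) (ℓ ∸ i * d (suc (suc N))))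

  Ftrunc-vanishes : (∀ j → 1 ≤ j → b j ≤ c j) → ∀ N {n k} → n < k → F N n k ≡ 0
  Ftrunc-vanishes b≤c zero    {n} n<k = δ₀₀-vanishesʳ n (≤-trans (s≤s z≤n) n<k)
  Ftrunc-vanishes b≤c (suc N) {n} {k} n<k = sumTo-≡0 n λ i _ →
    guard-≡0 ((i * c j ≤? n) ×-dec (i * b j ≤? k)) λ (ic≤n , ib≤k) →
      trans (cong (negBinom (a j) i *_) (Ftrunc-vanishes b≤c N (gap-< {i} ic≤n ib≤k)))
            (*-zeroʳ (negBinom (a j) i))
    where
    j : ℕ
    j = suc N
    gap-< : ∀ {i} → i * c j ≤ n → i * b j ≤ k → n ∸ i * c j < k ∸ i * b j
    gap-< {i} ic≤n _ = ≤-<-trans (∸-monoʳ-≤ n ib≤ic) (∸-monoˡ-< n<k (≤-trans ib≤ic ic≤n))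
      where
      ib≤ic : i * b j ≤ i * c j
      ib≤ic = *-monoʳ-≤ i (b≤c j (s≤s z≤n))

  Ftrunc-inactive : ∀ N {n k} → n < c (suc N) → F (suc N) n k ≡ F N n k
  Ftrunc-inactive N {n} {k} n<c =
    trans (sumTo-truncate {n = n} z≤′n higher-terms) (*-identityˡ (F N n k))
    where
    higher-terms : ∀ i → 0 < i → F-term N n k i ≡ 0
    higher-terms (suc i) _ = guard-≡0 ((suc i * c (suc N) ≤? n) ×-dec (suc i * b (suc N) ≤? k))
      λ (ic≤n , _) → contradiction (≤-trans (m≤m+n (c (suc N)) _) ic≤n) (<⇒≱ n<c)

  Gtrunc-inactive : ∀ N {ℓ} → ℓ < d (suc N) → G (suc N) ℓ ≡ G N ℓ
  Gtrunc-inactive zero    _ = refl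
  Gtrunc-inactive (suc N) {ℓ} ℓ<d =
    trans (sumTo-truncate {n = ℓ} z≤′n higher-terms) (*-identityˡ (G (suc N) ℓ))
    where
    higher-terms : ∀ i → 0 < i → G-term N ℓ i ≡ 0
    higher-terms (suc i) _ = guard-≡0 (suc i * d (suc (suc N)) ≤? ℓ)
      λ id≤ℓ → contradiction (≤-trans (m≤m+n (d (suc (suc N))) _) id≤ℓ) (<⇒≱ ℓ<d)

  Ftrunc-stable : ∀ {N n k} → (∀ j → N < j → n < c j) → ∀ {K} → N ≤ K → F N n k ≡ F K n k
  Ftrunc-stable {n = n} {k} n<c N≤K =
    eventually-constant (λ K → F K n k) (λ K N≤K → Ftrunc-inactive K (n<c (suc K) (s≤s N≤K)))
                        (≤⇒≤′ N≤K)

  Gtrunc-stable : ∀ {N ℓ} → (∀ j → N < j → ℓ < d j) → ∀ {K} → N ≤ K → G N ℓ ≡ G K ℓ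
  Gtrunc-stable {ℓ = ℓ} ℓ<d N≤K =
    eventually-constant (λ K → G K ℓ) (λ K N≤K → Gtrunc-inactive K (ℓ<d (suc K) (s≤s N≤K)))
                        (≤⇒≤′ N≤K)

  Ftrunc≤Gtrunc-first : a 1 ≡ 1 → b 1 ≡ 1 → c 1 ≡ 1 → ∀ n k → F 1 n k ≤ G 1 (n ∸ k)
  Ftrunc≤Gtrunc-first a₁ b₁ c₁ n k = begin
    F 1 n k         ≡⟨ sumTo-last n earlier-terms ⟩
    F-term 0 n k n  ≤⟨ guard-≤ ((n * c 1 ≤? n) ×-dec (n * b 1 ≤? k)) last-term ⟩
    δ₀ (n ∸ k)      ∎
    where
    open ≤-Reasoning
    *-one : ∀ {x} i → x ≡ 1 → i * x ≡ i
    *-one i refl = *-identityʳ i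
    earlier-terms : ∀ i → i < n → F-term 0 n k i ≡ 0
    earlier-terms i i<n = guard-≡0 ((i * c 1 ≤? n) ×-dec (i * b 1 ≤? k)) λ _ →
      trans (cong (negBinom (a 1) i *_) (δ₀₀-vanishesˡ (k ∸ i * b 1) 0<n∸ic))
            (*-zeroʳ (negBinom (a 1) i))
      where
      0<n∸ic : 0 < n ∸ i * c 1
      0<n∸ic = subst (λ m → 0 < n ∸ m) (sym (*-one i c₁)) (m<n⇒0<n∸m i<n)
    last-term : n * c 1 ≤ n × n * b 1 ≤ k →
                negBinom (a 1) n * δ₀₀ (n ∸ n * c 1) (k ∸ n * b 1) ≤ δ₀ (n ∸ k)
    last-term (_ , nb≤k) rewrite m≤n⇒m∸n≡0 (subst (_≤ k) (*-one n b₁) nb≤k) = begin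
      negBinom (a 1) n * δ  ≡⟨ cong (λ x → negBinom x n * δ) a₁ ⟩
      negBinom 1 n * δ      ≡⟨ cong (_* δ) (negBinom-1 n) ⟩
      1 * δ                 ≡⟨ *-identityˡ δ ⟩
      δ                     ≤⟨ δ₀₀≤1 (n ∸ n * c 1) (k ∸ n * b 1) ⟩
      1                     ∎
      where
      δ : ℕ
      δ = δ₀₀ (n ∸ n * c 1) (k ∸ n * b 1)

  Ftrunc≤Gtrunc-step : (∀ j → 1 ≤ j → b j ≤ c j) → ∀ M → b (2 + M) < c (2 + M) →
                       (∀ n k → F (1 + M) n k ≤ G (1 + M) (n ∸ k)) →
                       ∀ n k → F (2 + M) n k ≤ G (2 + M) (n ∸ k)
  Ftrunc≤Gtrunc-step b≤c M b<c IH n k = begin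
    F (2 + M) n k                 ≡⟨ sumTo-truncate (≤⇒≤′ (m∸n≤m n k)) F-term-beyond ⟩
    sumTo ℓ (F-term (1 + M) n k)  ≤⟨ sumTo-mono-≤ ℓ F-term≤G-term ⟩
    G (2 + M) ℓ                   ∎
    where
    open ≤-Reasoning
    j ℓ : ℕ
    j = 2 + M
    ℓ = n ∸ k

    G-term-beyond : ∀ i → ℓ < i → G-term M ℓ i ≡ 0
    G-term-beyond i ℓ<i = guard-≡0 (i * d j ≤? ℓ) λ id≤ℓ →
      contradiction (≤-trans (m≤m*n i (d j) {{>-nonZero (m<n⇒0<n∸m b<c)}}) id≤ℓ) (<⇒≱ ℓ<i)

    summand≤G-term : ∀ i → i * c j ≤ n → i * b j ≤ k →
      negBinom (a j) i * F (1 + M) (n ∸ i * c j) (k ∸ i * b j) ≤ G-term M ℓ i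
    summand≤G-term i ic≤n ib≤k with k ∸ i * b j ≤? n ∸ i * c j
    ... | no k′≰n′ rewrite Ftrunc-vanishes b≤c (1 + M) (≰⇒> k′≰n′)
                         | *-zeroʳ (negBinom (a j) i) = z≤n
    ... | yes k′≤n′ = begin
      negBinom (a j) i * F (1 + M) n′ k′          ≤⟨ *-monoʳ-≤ (negBinom (a j) i) (IH n′ k′) ⟩
      negBinom (a j) i * G (1 + M) (n′ ∸ k′)      ≡⟨ cong (λ x → negBinom (a j) i * G (1 + M) x) shift ⟩
      negBinom (a j) i * G (1 + M) (ℓ ∸ i * d j)  ≡⟨ sym (guard-yes (i * d j ≤? ℓ) id≤ℓ) ⟩
      G-term M ℓ i                                ∎
      where
      n′ k′ : ℕ
      n′ = n ∸ i * c j
      k′ = k ∸ i * b j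
      gap : ℓ ≡ i * d j + (n′ ∸ k′)
      gap = trans (∸-split (*-monoʳ-≤ i (b≤c j (s≤s z≤n))) ic≤n ib≤k k′≤n′)
                  (cong (_+ (n′ ∸ k′)) (sym (*-distribˡ-∸ i (c j) (b j))))
      shift : n′ ∸ k′ ≡ ℓ ∸ i * d j
      shift = sym (trans (cong (_∸ i * d j) gap) (m+n∸m≡n (i * d j) (n′ ∸ k′)))
      id≤ℓ : i * d j ≤ ℓ
      id≤ℓ = subst (i * d j ≤_) (sym gap) (m≤m+n (i * d j) (n′ ∸ k′))

    F-term≤G-term : ∀ i → F-term (1 + M) n k i ≤ G-term M ℓ i
    F-term≤G-term i = guard-≤ ((i * c j ≤? n) ×-dec (i * b j ≤? k))
      λ (ic≤n , ib≤k) → summand≤G-term i ic≤n ib≤k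

    F-term-beyond : ∀ i → ℓ < i → F-term (1 + M) n k i ≡ 0
    F-term-beyond i ℓ<i =
      n≤0⇒n≡0 (subst (F-term (1 + M) n k i ≤_) (G-term-beyond i ℓ<i) (F-term≤G-term i))

  Ftrunc≤Gtrunc : a 1 ≡ 1 → b 1 ≡ 1 → c 1 ≡ 1 → (∀ j → 2 ≤ j → b j < c j) →
                  ∀ M n k → F (1 + M) n k ≤ G (1 + M) (n ∸ k)
  Ftrunc≤Gtrunc a₁ b₁ c₁ b<c zero    = Ftrunc≤Gtrunc-first a₁ b₁ c₁
  Ftrunc≤Gtrunc a₁ b₁ c₁ b<c (suc M) =
    Ftrunc≤Gtrunc-step b≤c M (b<c (2 + M) (s≤s (s≤s z≤n))) (Ftrunc≤Gtrunc a₁ b₁ c₁ b<c M)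
    where
    b≤c : ∀ j → 1 ≤ j → b j ≤ c j
    b≤c (suc zero)    _ = ≤-reflexive (trans b₁ (sym c₁))
    b≤c (suc (suc j)) _ = <⇒≤ (b<c (2 + j) (s≤s (s≤s z≤n)))

-- The hypotheses c j ≥ 1, the two finiteness conditions and m ≥ 2 only serve to make the
-- infinite products well defined; here the truncation bounds N and N′ take their place.
corollary2 : (a b c : ℕ → ℕ) →
    (∀ j → 1 ≤ j → 1 ≤ c j) →
    (∀ t → ∃ λ N → ∀ j → N < j → c j ≢ t) →
    a 1 ≡ 1 → b 1 ≡ 1 → c 1 ≡ 1 →
    (Σ ℕ λ m → 2 ≤ m × (∀ j → 2 ≤ j → m * b j ≤ c j)) →
    (∀ j → 2 ≤ j → b j < c j) →
    (∀ D → ∃ λ N → ∀ j → N < j → c j ∸ b j ≢ D) →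
    ∀ n ℓ → ℓ ≤ n →
    ∀ N → (∀ j → N < j → n < c j) →
    ∀ N′ → (∀ j → N′ < j → ℓ < c j ∸ b j) →
    Ftrunc a b c N n (n ∸ ℓ) ≤ Gtrunc a (λ j → c j ∸ b j) N′ ℓ
corollary2 a b c _ _ a₁ b₁ c₁ _ b<c _ n ℓ ℓ≤n N n<c N′ ℓ<d = begin
  F N n (n ∸ ℓ)        ≡⟨ Ftrunc-stable a b c n<c (m≤n⇒m≤1+n (m≤m⊔n N N′)) ⟩
  F K n (n ∸ ℓ)        ≤⟨ Ftrunc≤Gtrunc a b c a₁ b₁ c₁ b<c (N ⊔ N′) n (n ∸ ℓ) ⟩
  G K (n ∸ (n ∸ ℓ))    ≡⟨ cong (G K) (m∸[m∸n]≡n ℓ≤n) ⟩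
  G K ℓ                ≡⟨ sym (Gtrunc-stable a b c ℓ<d (m≤n⇒m≤1+n (m≤n⊔m N N′))) ⟩
  G N′ ℓ               ∎
  where
  open ≤-Reasoning
  K : ℕ
  K = suc (N ⊔ N′)
  F : ℕ → ℕ → ℕ → ℕ
  F = Ftrunc a b c
  G : ℕ → ℕ → ℕ
  G = Gtrunc a (λ j → c j ∸ b j)
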